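{- Let $P\subset\mathbb{R}^3$ be a lattice polytope with $\Delta_P(x)=l_1\leq\Delta_P(y)=l_2\leq\Delta_P(z)=l$, where $l_1\geq1$. Suppose that $\Delta_P(x+y)\geq l_2$ and $\Delta_P(x-y)\geq l_2$. If $a,b\in\mathbb{Z}$ satisfy $\Delta_P(ax+by+z)<l$, then: (1) if $|a|\geq|b|$, then $|b|\leq\frac{2l-1}{l_2}$; (2) if $|b|\geq|a|$, then $|a|\leq\frac{2l-1}{l_1}$.
   Context: A lattice polytope is the convex hull of finitely many points of $\mathbb{Z}^3$. For a linear function $f$ with integer coefficients, $\Delta_P(f)=\max_{p\in P}f(p)-\min_{p\in P}f(p)$. -}

module Defs where

open import Data.Integer using (ℤ; +_; -_; _+_; _*_; _-_; _⊔_; _⊓_)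
open import Data.Product using (_×_; _,_)
open import Data.List.NonEmpty using (List⁺; _∷_)
open import Data.List using (List; []; _∷_)

Point : Set
Point = ℤ × ℤ × ℤ

-- A lattice polytope P = conv(V) is given by a nonempty finite list V of
-- lattice points (its generating points; repetitions / non-vertices allowed).
LatticePolytope : Set
LatticePolytope = List⁺ Point

Linear : Set
Linear = ℤ × ℤ × ℤ

eval : Linear → Point → ℤ
eval (c₁ , c₂ , c₃) (u , v , w) = c₁ * u + c₂ * v + c₃ * w

maxOn : Linear → Point → List Point → ℤ
maxOn f p []       = eval f p
maxOn f p (q ∷ qs) = eval f p ⊔ maxOn f q qs

minOn : Linear → Point → List Point → ℤ
minOn f p []       = eval f p
minOn f p (q ∷ qs) = eval f p ⊓ minOn f q qs

-- Δ_P(f) = max_{p∈P} f(p) − min_{p∈P} f(p).  Since f is linear, its max/min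
-- over conv(V) are attained at points of V.
Δ : LatticePolytope → Linear → ℤ
Δ (p ∷ ps) f = maxOn f p ps - minOn f p ps

x y z : Linear
x = (+ 1 , + 0 , + 0)
y = (+ 0 , + 1 , + 0)
z = (+ 0 , + 0 , + 1)

x+y x-y : Linear
x+y = (+ 1 , + 1 , + 0)
x-y = (+ 1 , - (+ 1) , + 0)

axbyz : ℤ → ℤ → Linear
axbyz a b = (a , b , + 1)

-- For a chord d = q − r of P (q, r ∈ P) and any linear f, −Δ_P(f) ≤ f(d) ≤ Δ_P(f).
-- Applied to f = ax + by + z and to z this gives |a d₁ + b d₂| ≤ (l − 1) + l = 2l − 1.
-- The widths Δ_P(x ± y) ≥ l₂ are attained by chords whose (x, y)-parts have coordinates
-- bounded by l₁ ≤ l₂ and l₂, so they lie in the closed quadrants of signs (+, +) and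
-- (+, −) with ℓ¹-length at least l₂; reversing a chord reaches the other two quadrants.
-- The chord whose quadrant matches the signs of (a, b) yields |a|U + |b|V ≤ 2l − 1 with
-- U, V ≥ 0 and U + V ≥ l₂, hence min(|a|, |b|) · l₂ ≤ 2l − 1.
{-# OPTIONS --safe #-}
module Submission where

open import Defs
open import Data.Integer using (ℤ; +_; -[1+_]; ∣_∣; _*_; _-_; _≤_; _<_; _+_; -_; +≤+; nonNegative)
import Data.Integer.Properties as ℤ
open import Data.Integer.Tactic.RingSolver using (solve-∀)
open import Data.Product using (_×_; _,_; ∃; ∃₂)
open import Data.Sum using (inj₁; inj₂)
open import Data.List using ([]; _∷_)
open import Data.List.NonEmpty using (toList; _∷_)
open import Data.List.Membership.Propositional using (_∈_)
open import Data.List.Relation.Unary.Any using (here; there)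
open import Relation.Binary.PropositionalEquality
  using (_≡_; refl; sym; trans; cong; cong₂; subst)
import Data.Nat as ℕ
import Data.Nat.Properties as ℕ

_⊖_ : Point → Point → Point
(q₁ , q₂ , q₃) ⊖ (r₁ , r₂ , r₃) = q₁ - r₁ , q₂ - r₂ , q₃ - r₃

⊝_ : Point → Point
⊝ (u , v , w) = - u , - v , - w

eval-⊖ : ∀ f q r → eval f (q ⊖ r) ≡ eval f q - eval f r
eval-⊖ (c₁ , c₂ , c₃) (q₁ , q₂ , q₃) (r₁ , r₂ , r₃) = linear c₁ c₂ c₃ q₁ q₂ q₃ r₁ r₂ r₃
  where
  linear : ∀ c₁ c₂ c₃ q₁ q₂ q₃ r₁ r₂ r₃ →
    c₁ * (q₁ - r₁) + c₂ * (q₂ - r₂) + c₃ * (q₃ - r₃) ≡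
    (c₁ * q₁ + c₂ * q₂ + c₃ * q₃) - (c₁ * r₁ + c₂ * r₂ + c₃ * r₃)
  linear = solve-∀

⊝-⊖ : ∀ q r → ⊝ (q ⊖ r) ≡ r ⊖ q
⊝-⊖ (q₁ , q₂ , q₃) (r₁ , r₂ , r₃) =
  cong₂ _,_ (neg-minus q₁ r₁) (cong₂ _,_ (neg-minus q₂ r₂) (neg-minus q₃ r₃))
  where
  neg-minus : ∀ i j → - (i - j) ≡ j - i
  neg-minus = solve-∀

eval-x : ∀ u v w → eval x (u , v , w) ≡ u
eval-x = unfolded
  where
  unfolded : ∀ u v w → + 1 * u + + 0 * v + + 0 * w ≡ u
  unfolded = solve-∀

eval-y : ∀ u v w → eval y (u , v , w) ≡ v
eval-y = unfolded
  where
  unfolded : ∀ u v w → + 0 * u + + 1 * v + + 0 * w ≡ v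
  unfolded = solve-∀

eval-z : ∀ u v w → eval z (u , v , w) ≡ w
eval-z = unfolded
  where
  unfolded : ∀ u v w → + 0 * u + + 0 * v + + 1 * w ≡ w
  unfolded = solve-∀

eval-x+y : ∀ u v w → eval x+y (u , v , w) ≡ u + v
eval-x+y = unfolded
  where
  unfolded : ∀ u v w → + 1 * u + + 1 * v + + 0 * w ≡ u + v
  unfolded = solve-∀

eval-x-y : ∀ u v w → eval x-y (u , v , w) ≡ u - v
eval-x-y = unfolded
  where
  unfolded : ∀ u v w → + 1 * u + - + 1 * v + + 0 * w ≡ u - v
  unfolded = solve-∀

eval≤maxOn : ∀ f {p ps q} → q ∈ p ∷ ps → eval f q ≤ maxOn f p ps
eval≤maxOn f {ps = []}     (here refl) = ℤ.≤-refl
eval≤maxOn f {ps = r ∷ ps} (here refl) = ℤ.i≤i⊔j _ _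
eval≤maxOn f {ps = r ∷ ps} (there q∈) = ℤ.≤-trans (eval≤maxOn f q∈) (ℤ.i≤j⊔i _ _)

minOn≤eval : ∀ f {p ps q} → q ∈ p ∷ ps → minOn f p ps ≤ eval f q
minOn≤eval f {ps = []}     (here refl) = ℤ.≤-refl
minOn≤eval f {ps = r ∷ ps} (here refl) = ℤ.i⊓j≤i _ _
minOn≤eval f {ps = r ∷ ps} (there q∈) = ℤ.≤-trans (ℤ.i⊓j≤j _ _) (minOn≤eval f q∈)

maxOn-attained : ∀ f p ps → ∃ λ q → q ∈ p ∷ ps × maxOn f p ps ≡ eval f q
maxOn-attained f p []       = p , here refl , refl
maxOn-attained f p (r ∷ ps) with ℤ.⊔-sel (eval f p) (maxOn f r ps)
... | inj₁ max≡p = p , here refl , max≡p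
... | inj₂ max≡rest with maxOn-attained f r ps
...   | q , q∈ , rest≡q = q , there q∈ , trans max≡rest rest≡q

minOn-attained : ∀ f p ps → ∃ λ q → q ∈ p ∷ ps × minOn f p ps ≡ eval f q
minOn-attained f p []       = p , here refl , refl
minOn-attained f p (r ∷ ps) with ℤ.⊓-sel (eval f p) (minOn f r ps)
... | inj₁ min≡p = p , here refl , min≡p
... | inj₂ min≡rest with minOn-attained f r ps
...   | q , q∈ , rest≡q = q , there q∈ , trans min≡rest rest≡q

data Chord (P : LatticePolytope) : Point → Set where
  chord : ∀ {q r} → q ∈ toList P → r ∈ toList P → Chord P (q ⊖ r)

Chord-reverse : ∀ {P d} → Chord P d → Chord P (⊝ d)
Chord-reverse {P} (chord {q} {r} q∈ r∈) = subst (Chord P) (sym (⊝-⊖ q r)) (chord r∈ q∈)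

eval-chord≤Δ : ∀ {P d} f → Chord P d → eval f d ≤ Δ P f
eval-chord≤Δ {p ∷ ps} f (chord {q} {r} q∈ r∈) =
  subst (_≤ Δ (p ∷ ps) f) (sym (eval-⊖ f q r))
    (ℤ.+-mono-≤ (eval≤maxOn f q∈) (ℤ.neg-mono-≤ (minOn≤eval f r∈)))

Δ-attained : ∀ P f → ∃ λ d → Chord P d × Δ P f ≡ eval f d
Δ-attained (p ∷ ps) f with maxOn-attained f p ps | minOn-attained f p ps
... | q , q∈ , max≡q | r , r∈ , min≡r =
  q ⊖ r , chord q∈ r∈ , trans (cong₂ _-_ max≡q min≡r) (sym (eval-⊖ f q r))

module _ {P : LatticePolytope} {u v w : ℤ} (c : Chord P (u , v , w)) where

  chord₁≤Δx : u ≤ Δ P x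
  chord₁≤Δx = subst (_≤ Δ P x) (eval-x u v w) (eval-chord≤Δ x c)

  chord₂≤Δy : v ≤ Δ P y
  chord₂≤Δy = subst (_≤ Δ P y) (eval-y u v w) (eval-chord≤Δ y c)

  -chord₂≤Δy : - v ≤ Δ P y
  -chord₂≤Δy = subst (_≤ Δ P y) (eval-y (- u) (- v) (- w)) (eval-chord≤Δ y (Chord-reverse c))

  -chord₃≤Δz : - w ≤ Δ P z
  -chord₃≤Δz = subst (_≤ Δ P z) (eval-z (- u) (- v) (- w)) (eval-chord≤Δ z (Chord-reverse c))

NonNegWithSum≥ : ℤ → ℤ → ℤ → Set
NonNegWithSum≥ l U V = + 0 ≤ U × + 0 ≤ V × l ≤ U + V

0≤-of-sum≥ : ∀ {l u v} → v ≤ l → l ≤ u + v → + 0 ≤ u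
0≤-of-sum≥ {u = u} {v} v≤l l≤u+v =
  subst (+ 0 ≤_) (cancel u v) (ℤ.i≤j⇒0≤j-i (ℤ.≤-trans v≤l l≤u+v))
  where
  cancel : ∀ u v → u + v - v ≡ u
  cancel = solve-∀

nonNegWithSum≥ : ∀ {l u v} → u ≤ l → v ≤ l → l ≤ u + v → NonNegWithSum≥ l u v
nonNegWithSum≥ {u = u} {v} u≤l v≤l l≤u+v =
  0≤-of-sum≥ v≤l l≤u+v , 0≤-of-sum≥ u≤l (subst (_ ≤_) (ℤ.+-comm u v) l≤u+v) , l≤u+v

Quadrant⁺⁺ Quadrant⁺⁻ : ℤ → Point → Set
Quadrant⁺⁺ l (u , v , _) = NonNegWithSum≥ l u v
Quadrant⁺⁻ l (u , v , _) = NonNegWithSum≥ l u (- v)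

sum-chord : ∀ P → Δ P x ≤ Δ P y → Δ P y ≤ Δ P x+y → ∃ λ d → Chord P d × Quadrant⁺⁺ (Δ P y) d
sum-chord P Δx≤Δy Δy≤Δ[x+y] with Δ-attained P x+y
... | (u , v , w) , c , Δ≡ =
  (u , v , w) , c ,
  nonNegWithSum≥ (ℤ.≤-trans (chord₁≤Δx c) Δx≤Δy) (chord₂≤Δy c)
    (subst (Δ P y ≤_) (trans Δ≡ (eval-x+y u v w)) Δy≤Δ[x+y])

difference-chord : ∀ P → Δ P x ≤ Δ P y → Δ P y ≤ Δ P x-y → ∃ λ d → Chord P d × Quadrant⁺⁻ (Δ P y) d
difference-chord P Δx≤Δy Δy≤Δ[x-y] with Δ-attained P x-y
... | (u , v , w) , c , Δ≡ =
  (u , v , w) , c ,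
  nonNegWithSum≥ (ℤ.≤-trans (chord₁≤Δx c) Δx≤Δy) (-chord₂≤Δy c)
    (subst (Δ P y ≤_) (trans Δ≡ (eval-x-y u v w)) Δy≤Δ[x-y])

combination-bound : ∀ {P a b u v w} → Δ P (axbyz a b) < Δ P z → Chord P (u , v , w) →
                    a * u + b * v ≤ + 2 * Δ P z - + 1
combination-bound {P} {a} {b} {u} {v} {w} Δf<Δz c = begin
  a * u + b * v                   ≡⟨ regroup a b u v w ⟩
  (+ 1 + f + - w) - + 1           ≤⟨ ℤ.+-monoˡ-≤ (- + 1) (ℤ.+-mono-≤ 1+f≤Δz (-chord₃≤Δz c)) ⟩
  (Δ P z + Δ P z) - + 1           ≡⟨ double (Δ P z) ⟩
  + 2 * Δ P z - + 1               ∎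
  where
  open ℤ.≤-Reasoning
  f = eval (axbyz a b) (u , v , w)
  1+f≤Δz : + 1 + f ≤ Δ P z
  1+f≤Δz = ℤ.i<j⇒suc[i]≤j (ℤ.≤-<-trans (eval-chord≤Δ (axbyz a b) c) Δf<Δz)
  regroup : ∀ a b u v w → a * u + b * v ≡ (+ 1 + (a * u + b * v + + 1 * w) + - w) - + 1
  regroup = solve-∀
  double : ∀ L → (L + L) - + 1 ≡ + 2 * L - + 1
  double = solve-∀

*-neg-swap : ∀ i j → i * (- j) ≡ (- i) * j
*-neg-swap = solve-∀

*-neg-neg : ∀ i j → i * j ≡ (- i) * (- j)
*-neg-neg = solve-∀

aligned-chord : ∀ {P l M} (a b : ℤ) →
  (∀ {u v w} → Chord P (u , v , w) → a * u + b * v ≤ M) →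
  (∃ λ d → Chord P d × Quadrant⁺⁺ l d) → (∃ λ d → Chord P d × Quadrant⁺⁻ l d) →
  ∃₂ λ U V → NonNegWithSum≥ l U V × + ∣ a ∣ * U + + ∣ b ∣ * V ≤ M
aligned-chord (+ m) (+ n) bound ((u , v , w) , c , uv) _ =
  u , v , uv , bound c
aligned-chord -[1+ m ] -[1+ n ] bound ((u , v , w) , c , uv) _ =
  u , v , uv ,
  subst (_≤ _) (cong₂ _+_ (*-neg-swap -[1+ m ] u) (*-neg-swap -[1+ n ] v)) (bound (Chord-reverse c))
aligned-chord (+ m) -[1+ n ] bound _ ((u , v , w) , c , uv) =
  u , - v , uv , subst (_≤ _) (cong (_+_ (+ m * u)) (*-neg-neg -[1+ n ] v)) (bound c)
aligned-chord -[1+ m ] (+ n) bound _ ((u , v , w) , c , uv) =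
  u , - v , uv , subst (_≤ _) (cong (_+ (+ n * - v)) (*-neg-swap -[1+ m ] u)) (bound (Chord-reverse c))

min-coefficient-bound : ∀ {l U V M} (A B : ℕ.ℕ) → NonNegWithSum≥ l U V → + A * U + + B * V ≤ M →
                   + (A ℕ.⊓ B) * l ≤ M
min-coefficient-bound {l} {U} {V} {M} A B (0≤U , 0≤V , l≤U+V) weighted≤M = begin
  + (A ℕ.⊓ B) * l                           ≤⟨ ℤ.*-monoˡ-≤-nonNeg (+ (A ℕ.⊓ B)) l≤U+V ⟩
  + (A ℕ.⊓ B) * (U + V)                     ≡⟨ ℤ.*-distribˡ-+ (+ (A ℕ.⊓ B)) U V ⟩
  + (A ℕ.⊓ B) * U + + (A ℕ.⊓ B) * V         ≤⟨ ℤ.+-mono-≤ (scale 0≤U (ℕ.m⊓n≤m A B)) (scale 0≤V (ℕ.m⊓n≤n A B)) ⟩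
  + A * U + + B * V                         ≤⟨ weighted≤M ⟩
  M                                         ∎
  where
  open ℤ.≤-Reasoning
  scale : ∀ {W m n} → + 0 ≤ W → m ℕ.≤ n → + m * W ≤ + n * W
  scale 0≤W m≤n = ℤ.*-monoʳ-≤-nonNeg _ {{nonNegative 0≤W}} (+≤+ m≤n)

mainTheorem5 : (P : LatticePolytope) (l₁ l₂ l : ℤ) →
    Δ P x ≡ l₁ → Δ P y ≡ l₂ → Δ P z ≡ l →
    l₁ ≤ l₂ → l₂ ≤ l → + 1 ≤ l₁ →
    l₂ ≤ Δ P x+y → l₂ ≤ Δ P x-y →
    (a b : ℤ) → Δ P (axbyz a b) < l →
    ((∣ b ∣ ℕ.≤ ∣ a ∣ → + ∣ b ∣ * l₂ ≤ + 2 * l - + 1)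
     × (∣ a ∣ ℕ.≤ ∣ b ∣ → + ∣ a ∣ * l₁ ≤ + 2 * l - + 1))
mainTheorem5 P l₁ l₂ l refl refl refl l₁≤l₂ _ _ l₂≤Δ[x+y] l₂≤Δ[x-y] a b Δf<l =
  let U , V , UV , weighted≤ = aligned-chord a b (combination-bound Δf<l)
                                 (sum-chord P l₁≤l₂ l₂≤Δ[x+y]) (difference-chord P l₁≤l₂ l₂≤Δ[x-y])
      min-bound = min-coefficient-bound ∣ a ∣ ∣ b ∣ UV weighted≤
  in (λ ∣b∣≤∣a∣ → subst (λ k → + k * l₂ ≤ + 2 * l - + 1) (ℕ.m≥n⇒m⊓n≡n ∣b∣≤∣a∣) min-bound)
   , (λ ∣a∣≤∣b∣ → ℤ.≤-trans (ℤ.*-monoˡ-≤-nonNeg (+ ∣ a ∣) l₁≤l₂)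
                    (subst (λ k → + k * l₂ ≤ + 2 * l - + 1) (ℕ.m≤n⇒m⊓n≡m ∣a∣≤∣b∣) min-bound))
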